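{- Let $P$ be a poset, $X,Y$ disjoint posets, $e_X:P\to X$ and $e_Y:P\to Y$ order embeddings, and let $i_X:X\to\overline{X}$ and $i_Y:Y\to\overline{Y}$ be order embeddings with $\overline{X}\cap\overline{Y}=\emptyset$. Define $R_l\subseteq X\times Y$ by $x\mathrel{R_l}y\iff e_X^{ -1}(x^\uparrow)\cap e_Y^{ -1}(y^\downarrow)\neq\emptyset$, and $S_l\subseteq\overline{X}\times\overline{Y}$ by $x'\mathrel{S_l}y'\iff (i_X\circ e_X)^{ -1}(x'^\uparrow)\cap(i_Y\circ e_Y)^{ -1}(y'^\downarrow)\neq\emptyset$. Define $\overline{R_l}\subseteq\overline{X}\times\overline{Y}$ by $x'\mathrel{\overline{R_l}}y'$ iff there exist $x\in X$, $y\in Y$ with $x'\le_{\overline{X}}i_X(x)$, $i_Y(y)\le_{\overline{Y}}y'$ and $x\mathrel{R_l}y$. Then $\overline{R_l}=S_l$.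
   Context: For a poset $Q$ and $q\in Q$, $q^\uparrow=\{r\in Q:r\ge q\}$ and $q^\downarrow=\{r\in Q:r\le q\}$; for a map $f$ and set $T$, $f^{ -1}(T)$ is the preimage. -}

module Defs where

open import Level using (Level; _⊔_)
open import Data.Product using (Σ; _×_; ∃-syntax)
open import Relation.Binary.Bundles using (Poset)

record IsOrderEmbedding {a₁ a₂ a₃ b₁ b₂ b₃ : Level}
    (A : Poset a₁ a₂ a₃) (B : Poset b₁ b₂ b₃)
    (f : Poset.Carrier A → Poset.Carrier B) : Set (a₁ ⊔ a₃ ⊔ b₃) where
  field
    monotone  : ∀ {x y} → Poset._≤_ A x y → Poset._≤_ B (f x) (f y)
    reflecting : ∀ {x y} → Poset._≤_ B (f x) (f y) → Poset._≤_ A x y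

module _ {p₁ p₂ p₃ x₁ x₂ x₃ y₁ y₂ y₃ : Level}
         (P : Poset p₁ p₂ p₃) (X : Poset x₁ x₂ x₃) (Y : Poset y₁ y₂ y₃)
         (eX : Poset.Carrier P → Poset.Carrier X)
         (eY : Poset.Carrier P → Poset.Carrier Y) where

  Rl : Poset.Carrier X → Poset.Carrier Y → Set (p₁ ⊔ x₃ ⊔ y₃)
  Rl x y = Σ (Poset.Carrier P) λ p → Poset._≤_ X x (eX p) × Poset._≤_ Y (eY p) y

module _ {p₁ p₂ p₃ x₁ x₂ x₃ y₁ y₂ y₃ a₁ a₂ a₃ b₁ b₂ b₃ : Level}
         (P : Poset p₁ p₂ p₃) (X : Poset x₁ x₂ x₃) (Y : Poset y₁ y₂ y₃)
         (X̄ : Poset a₁ a₂ a₃) (Ȳ : Poset b₁ b₂ b₃)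
         (eX : Poset.Carrier P → Poset.Carrier X)
         (eY : Poset.Carrier P → Poset.Carrier Y)
         (iX : Poset.Carrier X → Poset.Carrier X̄)
         (iY : Poset.Carrier Y → Poset.Carrier Ȳ) where

  Sl : Poset.Carrier X̄ → Poset.Carrier Ȳ → Set (p₁ ⊔ a₃ ⊔ b₃)
  Sl x' y' = Σ (Poset.Carrier P) λ p →
    Poset._≤_ X̄ x' (iX (eX p)) × Poset._≤_ Ȳ (iY (eY p)) y'

  Rlbar : Poset.Carrier X̄ → Poset.Carrier Ȳ →
          Set (p₁ ⊔ x₁ ⊔ x₃ ⊔ y₁ ⊔ y₃ ⊔ a₃ ⊔ b₃)
  Rlbar x' y' = ∃[ x ] ∃[ y ]
    (Poset._≤_ X̄ x' (iX x) × Poset._≤_ Ȳ (iY y) y' × Rl P X Y eX eY x y)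

module Submission where

open import Defs
open import Relation.Binary.Bundles using (Poset)
open import Function.Bundles using (_⇔_; mk⇔)
open import Data.Product using (_,_)

module _ {p₁ p₂ p₃ x₁ x₂ x₃ y₁ y₂ y₃ a₁ a₂ a₃ b₁ b₂ b₃}
         (P : Poset p₁ p₂ p₃) (X : Poset x₁ x₂ x₃) (Y : Poset y₁ y₂ y₃)
         (X̄ : Poset a₁ a₂ a₃) (Ȳ : Poset b₁ b₂ b₃)
         (eX : Poset.Carrier P → Poset.Carrier X)
         (eY : Poset.Carrier P → Poset.Carrier Y)
         (iX : Poset.Carrier X → Poset.Carrier X̄)
         (iY : Poset.Carrier Y → Poset.Carrier Ȳ) where

  Rlbar⇒Sl : (∀ {x y} → Poset._≤_ X x y → Poset._≤_ X̄ (iX x) (iX y)) →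
             (∀ {x y} → Poset._≤_ Y x y → Poset._≤_ Ȳ (iY x) (iY y)) →
             ∀ {x' y'} → Rlbar P X Y X̄ Ȳ eX eY iX iY x' y' →
             Sl P X Y X̄ Ȳ eX eY iX iY x' y'
  Rlbar⇒Sl iX-mono iY-mono (x , y , x'≤iXx , iYy≤y' , p , x≤eXp , eYp≤y) =
    p , Poset.trans X̄ x'≤iXx (iX-mono x≤eXp)
      , Poset.trans Ȳ (iY-mono eYp≤y) iYy≤y'

  Sl⇒Rlbar : ∀ {x' y'} → Sl P X Y X̄ Ȳ eX eY iX iY x' y' →
             Rlbar P X Y X̄ Ȳ eX eY iX iY x' y'
  Sl⇒Rlbar (p , x'≤iXeXp , iYeYp≤y') =
    eX p , eY p , x'≤iXeXp , iYeYp≤y' , p , Poset.refl X , Poset.refl Y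

lemma6p4 : ∀ {p₁ p₂ p₃ x₁ x₂ x₃ y₁ y₂ y₃ a₁ a₂ a₃ b₁ b₂ b₃}
    (P : Poset p₁ p₂ p₃) (X : Poset x₁ x₂ x₃) (Y : Poset y₁ y₂ y₃)
    (X̄ : Poset a₁ a₂ a₃) (Ȳ : Poset b₁ b₂ b₃)
    (eX : Poset.Carrier P → Poset.Carrier X)
    (eY : Poset.Carrier P → Poset.Carrier Y)
    (iX : Poset.Carrier X → Poset.Carrier X̄)
    (iY : Poset.Carrier Y → Poset.Carrier Ȳ) →
    IsOrderEmbedding P X eX → IsOrderEmbedding P Y eY →
    IsOrderEmbedding X X̄ iX → IsOrderEmbedding Y Ȳ iY →
    ∀ x' y' → Rlbar P X Y X̄ Ȳ eX eY iX iY x' y' ⇔ Sl P X Y X̄ Ȳ eX eY iX iY x' y'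
lemma6p4 P X Y X̄ Ȳ eX eY iX iY _ _ iX-emb iY-emb x' y' =
  mk⇔ (Rlbar⇒Sl P X Y X̄ Ȳ eX eY iX iY
         (IsOrderEmbedding.monotone iX-emb) (IsOrderEmbedding.monotone iY-emb))
      (Sl⇒Rlbar P X Y X̄ Ȳ eX eY iX iY)
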